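{- Let $L$ be a first-order language, $\mathcal M=\langle M,\dots\rangle$ an $L$-structure and $a,b\in M$ with $a\neq b$. Then: (i) there are choice functions $f$ for $\mathcal M$ such that $\langle\mathcal M,f\rangle\models^2_s\exists!v\,((v=a)|(v=b))$; (ii) there is no regular choice function $f$ for $\mathcal M$ such that $\langle\mathcal M,f\rangle\models^2_s\exists!v\,((v=a)|(v=b))$.
   Context: $L_s=L\cup\{|\}$ with $|$ a new binary connective; $L(M)$ is $L$ plus a constant for each element of $M$ (here $a,b$ are used as such constants). A choice function for $\mathcal M$ maps each unordered pair $\{\alpha,\beta\}$ of sentences of $L(M)$ to a member $f(\alpha,\beta)\in\{\alpha,\beta\}$ ($f(\alpha,\alpha)=\alpha$); it is regular if for all sentences $\alpha,\alpha',\beta$ of $L(M)$, $\alpha\sim\alpha'$ (first-order logical equivalence) implies $f(\alpha,\beta)\sim f(\alpha',\beta)$. Basic sentences: built from sentences of $L(M)$ by $\wedge,\vee,\rightarrow,\leftrightarrow,\neg,|$; restricted sentences: built from basic formulas by Boolean connectives and $\forall,\exists$ (not $|$). Collapse: $\overline f(\alpha)=\alpha$ for classical sentences, $\overline f$ commutes with $\wedge,\neg$, $\overline f(\varphi|\psi)=f(\overline f(\varphi),\overline f(\psi))$. Truth $\langle\mathcal M,f\rangle\models^2_s$: classical $\alpha$ iff $\mathcal M\models\alpha$; $\wedge,\neg$ as usual; $\varphi|\psi$ iff $\mathcal M\models f(\overline f(\varphi),\overline f(\psi))$; $\forall v\varphi(v)$ iff $\varphi(x)$ is true for all $x\in M$,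 and $\exists v\varphi(v)$ iff $\varphi(x)$ is true for some $x\in M$. $\exists!v\,\theta(v)$ abbreviates $\exists v(\theta(v)\wedge\forall u(\theta(u)\rightarrow u=v))$. -}

module Defs where

open import Level using (0ℓ)
open import Data.Nat using (ℕ; suc)
open import Data.Fin using (Fin; zero; suc)
open import Data.Vec using (Vec; []; _∷_; lookup)
open import Data.Product using (Σ; _×_; _,_)
open import Data.Sum using (_⊎_)
open import Relation.Nullary using (¬_)
open import Relation.Binary.Core using (Rel)
open import Relation.Binary.Structures using (IsStrictTotalOrder)
open import Relation.Binary.PropositionalEquality using (_≡_)

record Language : Set₁ where
  field
    FunSym : ℕ → Set   -- function symbols of each arity (constants: arity 0)
    RelSym : ℕ → Set

record Structure (L : Language) : Set₁ where
  open Language L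
  field
    Carrier : Set
    fun     : ∀ {k} → FunSym k → Vec Carrier k → Carrier
    rel     : ∀ {k} → RelSym k → Vec Carrier k → Set

open Structure public

-- Ordering principle (a consequence of AC, used classically in the paper):
-- every set carries a decidable strict total order.
OrderingPrinciple : Set₁
OrderingPrinciple = (A : Set) → Σ (Rel A 0ℓ) λ _<_ → IsStrictTotalOrder _≡_ _<_

_⇔ₚ_ : Set → Set → Set
A ⇔ₚ B = (A → B) × (B → A)

module FOL (L : Language) (M : Set) where
  open Language L

  -- terms of L(M) with n free variables (de Bruijn indices)
  data Term (n : ℕ) : Set where
    var : Fin n → Term n
    con : M → Term n
    app : ∀ {k} → FunSym k → Vec (Term n) k → Term n

  -- formulas of L(M); ∨, →, ↔, ∃ are abbreviations
  infix  6 _≐_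
  infixr 5 _∧ᶠ_
  data Formula (n : ℕ) : Set where
    _≐_  : Term n → Term n → Formula n
    rel' : ∀ {k} → RelSym k → Vec (Term n) k → Formula n
    ¬ᶠ_  : Formula n → Formula n
    _∧ᶠ_ : Formula n → Formula n → Formula n
    ∀ᶠ   : Formula (suc n) → Formula n      -- binds variable 0

  Sentence : Set
  Sentence = Formula 0

  mutual
    subT : ∀ {n m} → (Fin n → Term m) → Term n → Term m
    subT σ (var i)    = σ i
    subT σ (con x)    = con x
    subT σ (app g ts) = app g (subTs σ ts)

    subTs : ∀ {n m k} → (Fin n → Term m) → Vec (Term n) k → Vec (Term m) k
    subTs σ []       = []
    subTs σ (t ∷ ts) = subT σ t ∷ subTs σ ts

  wk : ∀ {n} → Term n → Term (suc n)
  wk = subT (λ i → var (suc i))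

  liftσ : ∀ {n m} → (Fin n → Term m) → Fin (suc n) → Term (suc m)
  liftσ σ zero    = var zero
  liftσ σ (suc i) = wk (σ i)

  subF : ∀ {n m} → (Fin n → Term m) → Formula n → Formula m
  subF σ (s ≐ t)    = subT σ s ≐ subT σ t
  subF σ (rel' r ts) = rel' r (subTs σ ts)
  subF σ (¬ᶠ φ)     = ¬ᶠ subF σ φ
  subF σ (φ ∧ᶠ ψ)   = subF σ φ ∧ᶠ subF σ ψ
  subF σ (∀ᶠ φ)     = ∀ᶠ (subF (liftσ σ) φ)

  closeF : ∀ {n} → Vec M n → Formula n → Sentence
  closeF ρ = subF (λ i → con (lookup ρ i))

  infixr 5 _∧ᵇ_
  infix  6 _∣_
  data Basic (n : ℕ) : Set where
    cl   : Formula n → Basic n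
    ¬ᵇ_  : Basic n → Basic n
    _∧ᵇ_ : Basic n → Basic n → Basic n
    _∣_  : Basic n → Basic n → Basic n

  closeB : ∀ {n} → Vec M n → Basic n → Basic 0
  closeB ρ (cl α)   = cl (closeF ρ α)
  closeB ρ (¬ᵇ φ)   = ¬ᵇ closeB ρ φ
  closeB ρ (φ ∧ᵇ ψ) = closeB ρ φ ∧ᵇ closeB ρ ψ
  closeB ρ (φ ∣ ψ)  = closeB ρ φ ∣ closeB ρ ψ

  infixr 5 _∧ʳ_
  data Restricted (n : ℕ) : Set where
    bas  : Basic n → Restricted n
    ¬ʳ_  : Restricted n → Restricted n
    _∧ʳ_ : Restricted n → Restricted n → Restricted n
    ∀ʳ   : Restricted (suc n) → Restricted n
    ∃ʳ   : Restricted (suc n) → Restricted n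

  _⇒ʳ_ : ∀ {n} → Restricted n → Restricted n → Restricted n
  φ ⇒ʳ ψ = ¬ʳ (φ ∧ʳ ¬ʳ ψ)

  -- Tarskian semantics of L(M) in an L(M)-structure ⟨N, c⟩
  -- (c interprets the new constants)

  module _ (N : Structure L) (c : M → Carrier N) where
    mutual
      evalT : ∀ {n} → Vec (Carrier N) n → Term n → Carrier N
      evalT ρ (var i)    = lookup ρ i
      evalT ρ (con x)    = c x
      evalT ρ (app g ts) = fun N g (evalTs ρ ts)

      evalTs : ∀ {n k} → Vec (Carrier N) n → Vec (Term n) k → Vec (Carrier N) k
      evalTs ρ []       = []
      evalTs ρ (t ∷ ts) = evalT ρ t ∷ evalTs ρ ts

    Sat : ∀ {n} → Vec (Carrier N) n → Formula n → Set
    Sat ρ (s ≐ t)     = evalT ρ s ≡ evalT ρ t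
    Sat ρ (rel' r ts) = rel N r (evalTs ρ ts)
    Sat ρ (¬ᶠ φ)      = ¬ Sat ρ φ
    Sat ρ (φ ∧ᶠ ψ)    = Sat ρ φ × Sat ρ ψ
    Sat ρ (∀ᶠ φ)      = (x : Carrier N) → Sat (x ∷ ρ) φ

  _∼_ : Sentence → Sentence → Set₁
  α ∼ β = (N : Structure L) (c : M → Carrier N) → Sat N c [] α ⇔ₚ Sat N c [] β

  -- Choice functions: a choice on unordered pairs {α,β} of sentences is
  -- a symmetric binary function selecting one of its arguments.

  IsChoiceFunction : (Sentence → Sentence → Sentence) → Set
  IsChoiceFunction f =
    (∀ α β → f α β ≡ f β α) × (∀ α β → (f α β ≡ α) ⊎ (f α β ≡ β))

  Regular : (Sentence → Sentence → Sentence) → Set₁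
  Regular f = ∀ α α' β → α ∼ α' → f α β ∼ f α' β

-- Semantics of L_s in ⟨𝓜, f⟩ (the constants of L(M) name themselves)
module Semantics (L : Language) (𝓜 : Structure L) where
  M = Carrier 𝓜
  open FOL L M public

  _⊨_ : Sentence → Set
  _⊨_ α = Sat 𝓜 (λ x → x) [] α

  module _ (f : Sentence → Sentence → Sentence) where
    collapse : Basic 0 → Sentence
    collapse (cl α)   = α
    collapse (¬ᵇ φ)   = ¬ᶠ collapse φ
    collapse (φ ∧ᵇ ψ) = collapse φ ∧ᶠ collapse ψ
    collapse (φ ∣ ψ)  = f (collapse φ) (collapse ψ)

    TrueB : Basic 0 → Set
    TrueB (cl α)   = _⊨_ α
    TrueB (¬ᵇ φ)   = ¬ TrueB φ
    TrueB (φ ∧ᵇ ψ) = TrueB φ × TrueB ψ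
    TrueB (φ ∣ ψ)  = _⊨_ (f (collapse φ) (collapse ψ))

    -- truth of restricted formulas under an assignment ρ of elements of M
    -- to the free variables (φ(x) = substituting the constant for x)
    TrueR : ∀ {n} → Vec M n → Restricted n → Set
    TrueR ρ (bas b)   = TrueB (closeB ρ b)
    TrueR ρ (¬ʳ φ)    = ¬ TrueR ρ φ
    TrueR ρ (φ ∧ʳ ψ)  = TrueR ρ φ × TrueR ρ ψ
    TrueR ρ (∀ʳ φ)    = (x : M) → TrueR (x ∷ ρ) φ
    TrueR ρ (∃ʳ φ)    = Σ M λ x → TrueR (x ∷ ρ) φ

    Models² : Restricted 0 → Set
    Models² = TrueR []

  θ : ∀ {n} → M → M → Fin n → Restricted n
  θ a b i = bas (cl (var i ≐ con a) ∣ cl (var i ≐ con b))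

  -- ∃!v θ(v) = ∃v (θ(v) ∧ ∀u (θ(u) → u = v));  inside ∀u: u = var 0, v = var 1
  ExistsUniqueAB : M → M → Restricted 0
  ExistsUniqueAB a b =
    ∃ʳ (θ a b zero ∧ʳ ∀ʳ (θ a b zero ⇒ʳ bas (cl (var zero ≐ var (suc zero)))))

-- θ(v) can hold only at a or at b, since f picks one of the two equations.
-- Regularity makes θ(a) and θ(b) equivalent: a = a ∼ b = b and a = b ∼ b = a,
-- so f picks "the same" equation in both pairs; hence θ holds at both or at
-- neither of two distinct elements, and ∃!v θ(v) fails.  Without regularity,
-- a choice function may pick the true a = a from the first pair and the false
-- b = a from the second; with a total order on sentences all other pairs can
-- be decided by taking the minimum.
module Submission where

open import Defs
open import Algebra.Core using (Op₂)
open import Algebra.Definitions using (Commutative; Selective)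
open import Data.Product using (Σ; _×_; _,_; proj₁; proj₂)
open import Data.Sum using (_⊎_; inj₁; inj₂)
open import Data.Empty using (⊥)
open import Data.Fin using (zero)
open import Data.Vec using (_∷_; [])
open import Function using (id; _∘_)
open import Relation.Binary.Bundles using (StrictTotalOrder)
open import Relation.Binary.Definitions using (DecidableEquality)
open import Relation.Binary.PropositionalEquality
  using (_≡_; _≢_; refl; sym; trans; cong; subst)
open import Relation.Nullary using (¬_; yes; no)
open import Relation.Nullary.Negation using (contradiction)
import Relation.Binary.Properties.StrictTotalOrder as StrictTotalOrderProperties
import Algebra.Construct.NaturalChoice.Min as NaturalChoiceMin

module _ {S : Set} (_≟_ : DecidableEquality S) where

  prefer : S → Op₂ S → Op₂ S
  prefer p g α β with α ≟ p | β ≟ p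
  ... | yes _ | _     = α
  ... | no _  | yes _ = β
  ... | no _  | no _  = g α β

  prefer-comm : ∀ {p g} → Commutative _≡_ g → Commutative _≡_ (prefer p g)
  prefer-comm {p} g-comm α β with α ≟ p | β ≟ p
  ... | yes α≡p | yes β≡p = trans α≡p (sym β≡p)
  ... | yes _   | no _    = refl
  ... | no _    | yes _   = refl
  ... | no _    | no _    = g-comm α β

  prefer-sel : ∀ {p g} → Selective _≡_ g → Selective _≡_ (prefer p g)
  prefer-sel {p} g-sel α β with α ≟ p | β ≟ p
  ... | yes _ | _     = inj₁ refl
  ... | no _  | yes _ = inj₂ refl
  ... | no _  | no _  = g-sel α β

  prefer-chosen : ∀ {g} p β → prefer p g p β ≡ p
  prefer-chosen p β with p ≟ p
  ... | yes _  = refl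
  ... | no p≢p = contradiction refl p≢p

  prefer-skip : ∀ {p g α β} → α ≢ p → β ≢ p → prefer p g α β ≡ g α β
  prefer-skip {p} {α = α} {β} α≢p β≢p with α ≟ p | β ≟ p
  ... | yes α≡p | _       = contradiction α≡p α≢p
  ... | no _    | yes β≡p = contradiction β≡p β≢p
  ... | no _    | no _    = refl

⇔ₚ-trans : {A B C : Set} → A ⇔ₚ B → B ⇔ₚ C → A ⇔ₚ C
⇔ₚ-trans (A⇒B , B⇒A) (B⇒C , C⇒B) = B⇒C ∘ A⇒B , B⇒A ∘ C⇒B

≡⇒⇔ₚ : {A B : Set} → A ≡ B → A ⇔ₚ B
≡⇒⇔ₚ refl = id , id

module _ (L : Language) (𝓜 : Structure L) where
  open Semantics L 𝓜

  ≐-refl-∼ : (s t : Term 0) → (s ≐ s) ∼ (t ≐ t)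
  ≐-refl-∼ s t N c = (λ _ → refl) , (λ _ → refl)

  ≐-sym-∼ : (s t : Term 0) → (s ≐ t) ∼ (t ≐ s)
  ≐-sym-∼ s t N c = sym , sym

  regular-cong₂ : ∀ {f α α' β β'} → IsChoiceFunction f → Regular f →
                  α ∼ α' → β ∼ β' → f α β ∼ f α' β'
  regular-cong₂ {f} {α} {α'} {β} {β'} (comm , _) reg α∼α' β∼β' N c =
    ⇔ₚ-trans (reg α α' β α∼α' N c)
      (⇔ₚ-trans (≡⇒⇔ₚ (cong (Sat N c []) (comm α' β)))
        (⇔ₚ-trans (reg β β' α' β∼β' N c) (≡⇒⇔ₚ (cong (Sat N c []) (comm β' α')))))

  module _ (a b : M) (f : Sentence → Sentence → Sentence) where

    θ-holds : M → Set
    θ-holds x = TrueR f (x ∷ []) (θ a b zero)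

    θ-holds⇒≡⊎≡ : IsChoiceFunction f → ∀ {x} → θ-holds x → x ≡ a ⊎ x ≡ b
    θ-holds⇒≡⊎≡ (_ , sel) {x} θx with sel (con x ≐ con a) (con x ≐ con b)
    ... | inj₁ picks-a = inj₁ (subst _⊨_ picks-a θx)
    ... | inj₂ picks-b = inj₂ (subst _⊨_ picks-b θx)

    θ-holds-only-at-a⇒∃! : IsChoiceFunction f → θ-holds a → ¬ θ-holds b →
                           Models² f (ExistsUniqueAB a b)
    θ-holds-only-at-a⇒∃! cf θa ¬θb = a , θa , λ u (θu , u≢a) → u≢a (θu⇒u≡a θu)
      where
      θu⇒u≡a : ∀ {u} → θ-holds u → u ≡ a
      θu⇒u≡a θu with θ-holds⇒≡⊎≡ cf θu
      ... | inj₁ u≡a = u≡a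
      ... | inj₂ refl = contradiction θu ¬θb

    ∃!⇒θ-holds-at-most-once : Models² f (ExistsUniqueAB a b) →
                              ∀ {u w} → u ≢ w → θ-holds u → θ-holds w → ⊥
    ∃!⇒θ-holds-at-most-once (_ , _ , unique) {u} {w} u≢w θu θw =
      unique u (θu , λ u≡x → unique w (θw , λ w≡x → u≢w (trans u≡x (sym w≡x))))

    θa⇔θb⇒¬∃! : a ≢ b → IsChoiceFunction f → θ-holds a ⇔ₚ θ-holds b →
                ¬ Models² f (ExistsUniqueAB a b)
    θa⇔θb⇒¬∃! a≢b cf (a⇒b , b⇒a) ∃!θ@(_ , θx , _) with θ-holds⇒≡⊎≡ cf θx
    ... | inj₁ refl = ∃!⇒θ-holds-at-most-once ∃!θ a≢b θx (a⇒b θx)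
    ... | inj₂ refl = ∃!⇒θ-holds-at-most-once ∃!θ a≢b (b⇒a θx) θx

    regular⇒θa⇔θb : IsChoiceFunction f → Regular f → θ-holds a ⇔ₚ θ-holds b
    regular⇒θa⇔θb cf@(comm , _) reg =
      ⇔ₚ-trans (regular-cong₂ cf reg (≐-refl-∼ (con a) (con b)) (≐-sym-∼ (con a) (con b)) 𝓜 id)
               (≡⇒⇔ₚ (cong _⊨_ (comm (con b ≐ con b) (con b ≐ con a))))

  biased-choice : ∀ {a b} → a ≢ b → OrderingPrinciple →
    Σ (Sentence → Sentence → Sentence) λ f →
      IsChoiceFunction f × θ-holds a b f a × ¬ θ-holds a b f b
  biased-choice {a} {b} a≢b op =
    f , cf , subst _⊨_ (sym f-picks-a≐a) refl , a≢b ∘ sym ∘ subst _⊨_ f-picks-b≐a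
    where
    sto : StrictTotalOrder _ _ _
    sto = record { isStrictTotalOrder = proj₂ (op Sentence) }
    open StrictTotalOrder sto using (_≟_)
    open StrictTotalOrderProperties sto using (totalOrder)
    open NaturalChoiceMin totalOrder using (_⊓_; ⊓-comm; ⊓-sel)

    f : Sentence → Sentence → Sentence
    f = prefer _≟_ (con a ≐ con a) (prefer _≟_ (con b ≐ con a) _⊓_)

    cf : IsChoiceFunction f
    cf = prefer-comm _≟_ (prefer-comm _≟_ ⊓-comm) , prefer-sel _≟_ (prefer-sel _≟_ ⊓-sel)

    f-picks-a≐a : f (con a ≐ con a) (con a ≐ con b) ≡ (con a ≐ con a)
    f-picks-a≐a = prefer-chosen _≟_ (con a ≐ con a) (con a ≐ con b)

    f-picks-b≐a : f (con b ≐ con a) (con b ≐ con b) ≡ (con b ≐ con a)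
    f-picks-b≐a = trans (prefer-skip _≟_ (λ { refl → a≢b refl }) (λ { refl → a≢b refl }))
                        (prefer-chosen _≟_ (con b ≐ con a) (con b ≐ con b))

proposition5p13 : (L : Language) (𝓜 : Structure L) (a b : Carrier 𝓜) → a ≢ b →
    let open Semantics L 𝓜 in
    (OrderingPrinciple →
    Σ (Sentence → Sentence → Sentence) λ f →
    IsChoiceFunction f × Models² f (ExistsUniqueAB a b))
    ×
    ((f : Sentence → Sentence → Sentence) →
    IsChoiceFunction f → Regular f → ¬ Models² f (ExistsUniqueAB a b))
proposition5p13 L 𝓜 a b a≢b =
  (λ op → let f , cf , θa , ¬θb = biased-choice L 𝓜 a≢b op in
          f , cf , θ-holds-only-at-a⇒∃! L 𝓜 a b f cf θa ¬θb) ,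
  (λ f cf reg → θa⇔θb⇒¬∃! L 𝓜 a b f a≢b cf (regular⇒θa⇔θb L 𝓜 a b f cf reg))
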